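{- For all integers $n\ge3$ and $1\le d\le n-2$ and $m\ge d$, the Graver complexity of $m\times n$ integer matrices of rank $d$ may be arbitrarily large: for every positive integer $N$ there exists $A\in\mathbb{Z}^{m\times n}$ of rank $d$ with $g(A)\ge N$.
   Context: For $A\in\mathbb{Z}^{m\times n}$ and $r\ge2$, the $r$-th Lawrence lifting $A^{(r)}$ is the $(rm+n)\times rn$ matrix with $r$ copies of $A$ on the block diagonal and final block row $(I_n\ I_n\ \cdots\ I_n)$. Elements of $\operatorname{Ker}_{\mathbb{Z}}(A^{(r)})$ are identified with $r\times n$ integer matrices whose rows lie in $\operatorname{Ker}_{\mathbb{Z}}(A)$ and sum to zero; the type of such an element is its number of nonzero rows. The Graver basis of an integer matrix $M$ is the set of nonzero $\mathbf{u}\in\operatorname{Ker}_{\mathbb{Z}}(M)$ admitting no proper conformal decomposition, i.e. no expression $\mathbf{u}=\mathbf{v}+\mathbf{w}$ with $\mathbf{v},\mathbf{w}\in\operatorname{Ker}_{\mathbb{Z}}(M)$ both nonzero, $\mathbf{u}^+=\mathbf{v}^++\mathbf{w}^+$ and $\mathbf{u}^-=\mathbf{v}^-+\mathbf{w}^-$ (where $\mathbf{x}=\mathbf{x}^+-\mathbf{x}^-$ with $\mathbf{x}^\pm$ nonnegative of disjoint support). The Graver complexity $g(A)$ is the largest type of any element of the Graver basis of $A^{(r)}$, as $r\ge2$ varies. -}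

module Defs where

open import Data.Nat as ℕ using (ℕ; zero; suc)
open import Data.Integer using (ℤ; 0ℤ; 1ℤ; _+_; _*_; -_; _⊔_)
open import Data.Fin using (Fin; splitAt; remQuot; combine; _≟_)
open import Data.Fin.Properties using (all?)
open import Data.Sum using (inj₁; inj₂)
open import Data.Product using (_×_; _,_; Σ; ∃)
open import Relation.Nullary using (¬_; does)
open import Relation.Binary.PropositionalEquality using (_≡_)
open import Function.Definitions using (Injective)
open import Data.Bool using (Bool; true; false; if_then_else_)
import Data.Integer.Properties as ℤP

Matrix : ℕ → ℕ → Set
Matrix m n = Fin m → Fin n → ℤ

Vector : ℕ → Set
Vector n = Fin n → ℤ

sumℤ : ∀ {n} → (Fin n → ℤ) → ℤ
sumℤ {zero}  f = 0ℤ
sumℤ {suc n} f = f Data.Fin.zero + sumℤ (λ i → f (Data.Fin.suc i))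

countFin : ∀ {n} → (Fin n → Bool) → ℕ
countFin {zero}  b = 0
countFin {suc n} b = (if b Data.Fin.zero then 1 else 0) ℕ.+ countFin (λ i → b (Data.Fin.suc i))

_·_ : ∀ {m n} → Matrix m n → Vector n → Vector m
(A · u) i = sumℤ (λ j → A i j * u j)

IsZero : ∀ {n} → Vector n → Set
IsZero u = ∀ j → u j ≡ 0ℤ

InKer : ∀ {m n} → Matrix m n → Vector n → Set
InKer A u = IsZero (A · u)

RowsIndependent : ∀ {m n k} → Matrix m n → (Fin k → Fin m) → Set
RowsIndependent A f =
  ∀ (c : Fin _ → ℤ) → (∀ j → sumℤ (λ i → c i * A (f i) j) ≡ 0ℤ) → IsZero c

HasRank : ∀ {m n} → Matrix m n → ℕ → Set
HasRank {m} A d =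
  (Σ (Fin d → Fin m) λ f → Injective _≡_ _≡_ f × RowsIndependent A f)
  × (∀ (g : Fin (suc d) → Fin m) → Injective _≡_ _≡_ g → ¬ RowsIndependent A g)

pos neg : ℤ → ℤ
pos x = x ⊔ 0ℤ
neg x = (- x) ⊔ 0ℤ

ConformalDecomp : ∀ {m n} → Matrix m n → Vector n → Vector n → Vector n → Set
ConformalDecomp M u v w =
  InKer M v × InKer M w × ¬ IsZero v × ¬ IsZero w
  × (∀ j → u j ≡ v j + w j)
  × (∀ j → pos (u j) ≡ pos (v j) + pos (w j))
  × (∀ j → neg (u j) ≡ neg (v j) + neg (w j))

InGraver : ∀ {m n} → Matrix m n → Vector n → Set
InGraver M u =
  InKer M u × ¬ IsZero u × (∀ v w → ¬ ConformalDecomp M u v w)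

-- r-th Lawrence lifting, an (r*m + n) × (r*n) matrix.
-- Row index: first r*m rows are (block b, row k) via combine b k;
-- last n rows are the identity blocks. Column index (block b, column l).
lawrence : ∀ {m n} (r : ℕ) → Matrix m n → Matrix (r ℕ.* m ℕ.+ n) (r ℕ.* n)
lawrence {m} {n} r A i j with splitAt (r ℕ.* m) i | remQuot {r} n j
... | inj₁ i' | (b' , l) with remQuot {r} m i'
...   | (b , k) = if does (b ≟ b') then A k l else 0ℤ
lawrence {m} {n} r A i j | inj₂ k | (b' , l) = if does (k ≟ l) then 1ℤ else 0ℤ

-- the b-th row of u ∈ ℤ^{rn} viewed as an r × n matrix
row : ∀ {n} (r : ℕ) → Vector (r ℕ.* n) → Fin r → Vector n
row r u b l = u (combine b l)

type : ∀ {n} (r : ℕ) → Vector (r ℕ.* n) → ℕ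
type {n} r u = countFin (λ b → Data.Bool.not (does (all? (λ l → row r u b l ℤP.≟ 0ℤ))))

GraverComplexityAtLeast : ∀ {m n} → Matrix m n → ℕ → Set
GraverComplexityAtLeast {m} {n} A N =
  ∃ λ r → 2 ℕ.≤ r × Σ (Vector (r ℕ.* n)) λ u → InGraver (lawrence r A) u × N ℕ.≤ type r u

-- Take A with first row (1, 1, K, 0, …, 0), d − 1 further rows the unit vectors
-- e₄, …, e_{d+2}, and all remaining rows zero; it has rank d. The (K + 2) × n matrix
-- with rows (−K, 0, 1, 0…), (0, K, −1, 0…) and K copies of (1, −1, 0, 0…) has rows in
-- Ker A and columns summing to zero, so it lies in Ker A^(K+2) and has type K + 2.
-- It is primitive: an element conformally below it that vanishes in the entry carrying
-- the 1 of the first row is forced to vanish everywhere by the kernel equations, and in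
-- a conformal decomposition one of the two summands vanishes in that entry.
module Submission where

open import Defs
open import Data.Nat as ℕ using (ℕ; zero; suc; s≤s; z≤n; _≤_; _∸_)
import Data.Nat.Properties as ℕP
open import Data.Integer as ℤ using (ℤ; 0ℤ; 1ℤ; -1ℤ; _+_; _*_; -_; +_; -[1+_]; +≤+)
import Data.Integer.Properties as ℤP
open import Data.Integer.Tactic.RingSolver using (solve-∀)
open import Data.Fin using (Fin; zero; suc; join; splitAt; combine; remQuot; toℕ; inject≤; fromℕ<; _≟_; _↑ˡ_; _↑ʳ_)
import Data.Fin.Properties as FP
open import Data.Sum using (inj₁; inj₂; _⊎_; [_,_]′)
open import Data.Product using (_×_; _,_; Σ; ∃; proj₁; proj₂; map₂; uncurry)
open import Data.Bool using (Bool; true; false; if_then_else_; not; _∧_)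
open import Data.Bool.Properties using (if-float)
open import Function using (_∘_)
open import Function.Definitions using (Injective)
open import Relation.Nullary using (¬_; Dec; does; yes; no; contradiction)
open import Relation.Nullary.Decidable using (dec-true; dec-false)
open import Relation.Binary.PropositionalEquality
open ≡-Reasoning

1ℤ≢0ℤ : 1ℤ ≢ 0ℤ
1ℤ≢0ℤ ()

-- Finite sums

sumℤ-cong : ∀ {n} {f g : Fin n → ℤ} → (∀ i → f i ≡ g i) → sumℤ f ≡ sumℤ g
sumℤ-cong {zero}  f≗g = refl
sumℤ-cong {suc n} f≗g = cong₂ _+_ (f≗g zero) (sumℤ-cong (f≗g ∘ suc))

sumℤ-zero : ∀ {n} {f : Fin n → ℤ} → (∀ i → f i ≡ 0ℤ) → sumℤ f ≡ 0ℤ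
sumℤ-zero {zero}  f≡0 = refl
sumℤ-zero {suc n} f≡0 = cong₂ _+_ (f≡0 zero) (sumℤ-zero (f≡0 ∘ suc))

sumℤ-const : ∀ {n} (x : ℤ) → sumℤ {n} (λ _ → x) ≡ + n * x
sumℤ-const {zero}  x = refl
sumℤ-const {suc n} x = begin
  x + sumℤ {n} (λ _ → x)  ≡⟨ cong₂ _+_ (sym (ℤP.*-identityˡ x)) (sumℤ-const {n} x) ⟩
  1ℤ * x + + n * x        ≡⟨ ℤP.*-distribʳ-+ x 1ℤ (+ n) ⟨
  + suc n * x             ∎

sumℤ-single : ∀ {n} (f : Fin n → ℤ) i₀ → (∀ i → i₀ ≢ i → f i ≡ 0ℤ) → sumℤ f ≡ f i₀
sumℤ-single f zero off = begin
  f zero + sumℤ (f ∘ suc)  ≡⟨ cong (_+_ (f zero)) (sumℤ-zero (λ i → off (suc i) λ ())) ⟩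
  f zero + 0ℤ              ≡⟨ ℤP.+-identityʳ (f zero) ⟩
  f zero                   ∎
sumℤ-single f (suc i₀) off = begin
  f zero + sumℤ (f ∘ suc)  ≡⟨ cong (_+ sumℤ (f ∘ suc)) (off zero λ ()) ⟩
  0ℤ + sumℤ (f ∘ suc)      ≡⟨ ℤP.+-identityˡ _ ⟩
  sumℤ (f ∘ suc)           ≡⟨ sumℤ-single (f ∘ suc) i₀ (λ i i₀≢i → off (suc i) (i₀≢i ∘ FP.suc-injective)) ⟩
  f (suc i₀)               ∎

sumℤ-select : ∀ {n} (i₀ : Fin n) (f : Fin n → ℤ) →
  sumℤ (λ i → if does (i₀ ≟ i) then f i else 0ℤ) ≡ f i₀
sumℤ-select i₀ f = begin
  sumℤ (λ i → if does (i₀ ≟ i) then f i else 0ℤ)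
    ≡⟨ sumℤ-single _ i₀ (λ i i₀≢i → cong (if_then f i else 0ℤ) (dec-false (i₀ ≟ i) i₀≢i)) ⟩
  (if does (i₀ ≟ i₀) then f i₀ else 0ℤ)
    ≡⟨ cong (if_then f i₀ else 0ℤ) (dec-true (i₀ ≟ i₀) refl) ⟩
  f i₀ ∎

sumℤ-if : ∀ {n} (c : Bool) (f : Fin n → ℤ) →
  sumℤ (λ i → if c then f i else 0ℤ) ≡ (if c then sumℤ f else 0ℤ)
sumℤ-if true  f = refl
sumℤ-if {n} false f = sumℤ-zero {n} (λ _ → refl)

sumℤ-++ : ∀ m {n} (f : Fin (m ℕ.+ n) → ℤ) →
  sumℤ f ≡ sumℤ (λ i → f (i ↑ˡ n)) + sumℤ (λ i → f (m ↑ʳ i))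
sumℤ-++ zero    f = sym (ℤP.+-identityˡ (sumℤ f))
sumℤ-++ (suc m) f = trans (cong (_+_ (f zero)) (sumℤ-++ m (f ∘ suc))) (sym (ℤP.+-assoc (f zero) _ _))

sumℤ-combine : ∀ r n (f : Fin (r ℕ.* n) → ℤ) →
  sumℤ f ≡ sumℤ (λ (b : Fin r) → sumℤ (λ (l : Fin n) → f (combine b l)))
sumℤ-combine zero    n f = refl
sumℤ-combine (suc r) n f =
  trans (sumℤ-++ n f) (cong (_+_ (sumℤ (λ l → f (l ↑ˡ r ℕ.* n)))) (sumℤ-combine r n (f ∘ (n ↑ʳ_))))

sumℤ-nonneg : ∀ {n} {f : Fin n → ℤ} → (∀ i → 0ℤ ℤ.≤ f i) → 0ℤ ℤ.≤ sumℤ f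
sumℤ-nonneg {zero}  f≥0 = ℤP.≤-refl
sumℤ-nonneg {suc n} f≥0 = ℤP.+-mono-≤ (f≥0 zero) (sumℤ-nonneg (f≥0 ∘ suc))

nonneg-sum≡0 : ∀ {a b} → 0ℤ ℤ.≤ a → 0ℤ ℤ.≤ b → a + b ≡ 0ℤ → a ≡ 0ℤ × b ≡ 0ℤ
nonneg-sum≡0 {+ zero}  {+ zero}  _ _ _  = refl , refl
nonneg-sum≡0 {+ zero}  {+ suc _} _ _ ()
nonneg-sum≡0 {+ suc _} {+ _}     _ _ ()

sumℤ-nonneg≡0⇒≡0 : ∀ {n} {f : Fin n → ℤ} → (∀ i → 0ℤ ℤ.≤ f i) → sumℤ f ≡ 0ℤ → ∀ i → f i ≡ 0ℤ
sumℤ-nonneg≡0⇒≡0 f≥0 Σ≡0 zero    = proj₁ (nonneg-sum≡0 (f≥0 zero) (sumℤ-nonneg (f≥0 ∘ suc)) Σ≡0)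
sumℤ-nonneg≡0⇒≡0 f≥0 Σ≡0 (suc i) =
  sumℤ-nonneg≡0⇒≡0 (f≥0 ∘ suc) (proj₂ (nonneg-sum≡0 (f≥0 zero) (sumℤ-nonneg (f≥0 ∘ suc)) Σ≡0)) i

x+[y+z]≡0⇒x≡0 : ∀ {x y z} → y ≡ 0ℤ → z ≡ 0ℤ → x + (y + z) ≡ 0ℤ → x ≡ 0ℤ
x+[y+z]≡0⇒x≡0 {x} refl refl sum≡0 = trans (sym (ℤP.+-identityʳ x)) sum≡0

x+[y+z]≡0⇒y≡0 : ∀ {x y z} → x ≡ 0ℤ → z ≡ 0ℤ → x + (y + z) ≡ 0ℤ → y ≡ 0ℤ
x+[y+z]≡0⇒y≡0 {y = y} refl refl sum≡0 =
  trans (sym (trans (ℤP.+-identityˡ (y + 0ℤ)) (ℤP.+-identityʳ y))) sum≡0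

x+[y+z]≡0⇒z≡0 : ∀ {x y z} → x ≡ 0ℤ → y ≡ 0ℤ → x + (y + z) ≡ 0ℤ → z ≡ 0ℤ
x+[y+z]≡0⇒z≡0 {z = z} refl refl sum≡0 =
  trans (sym (trans (ℤP.+-identityˡ (0ℤ + z)) (ℤP.+-identityˡ z))) sum≡0

-- Conformal order

record _≼_ (x y : ℤ) : Set where
  constructor ≼⁺⁻
  field
    pos-≤ : pos x ℤ.≤ pos y
    neg-≤ : neg x ℤ.≤ neg y

_⊑_ : ∀ {n} → Vector n → Vector n → Set
v ⊑ u = ∀ j → v j ≼ u j

≼0⇒≡0 : ∀ {x} → x ≼ 0ℤ → x ≡ 0ℤ
≼0⇒≡0 {+ zero}    _ = refl
≼0⇒≡0 {+ suc _}   (≼⁺⁻ (+≤+ ()) _)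
≼0⇒≡0 { -[1+ _ ]} (≼⁺⁻ _ (+≤+ ()))

≼-nonneg : ∀ {x y} → x ≼ y → 0ℤ ℤ.≤ y → 0ℤ ℤ.≤ x
≼-nonneg {+ _}                  _ _ = +≤+ z≤n
≼-nonneg { -[1+ _ ]} {+ zero}  (≼⁺⁻ _ (+≤+ ())) _
≼-nonneg { -[1+ _ ]} {+ suc _} (≼⁺⁻ _ (+≤+ ())) _

summand-≼ : ∀ {x y z} → pos x ≡ pos y + pos z → neg x ≡ neg y + neg z → y ≼ x
summand-≼ {y = y} {z} pos-split neg-split = ≼⁺⁻
  (subst (pos y ℤ.≤_) (sym pos-split) (ℤP.i≤i+j _ _ {{ℤ.nonNegative (ℤP.i≤j⊔i z 0ℤ)}}))
  (subst (neg y ℤ.≤_) (sym neg-split) (ℤP.i≤i+j _ _ {{ℤ.nonNegative (ℤP.i≤j⊔i (- z) 0ℤ)}}))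

ConformalDecomp⇒⊑ : ∀ {m n} {M : Matrix m n} {u v w} →
  ConformalDecomp M u v w → v ⊑ u × w ⊑ u
ConformalDecomp⇒⊑ {v = v} {w} (_ , _ , _ , _ , _ , pos-split , neg-split) =
  (λ j → summand-≼ (pos-split j) (neg-split j)) ,
  (λ j → summand-≼ (trans (pos-split j) (ℤP.+-comm (pos (v j)) (pos (w j))))
                   (trans (neg-split j) (ℤP.+-comm (neg (v j)) (neg (w j)))))

nonneg-sum≡1 : ∀ {a b} → 0ℤ ℤ.≤ a → 0ℤ ℤ.≤ b → a + b ≡ 1ℤ → a ≡ 0ℤ ⊎ b ≡ 0ℤ
nonneg-sum≡1 {+ zero}              _ _ _ = inj₁ refl
nonneg-sum≡1 {+ suc _} {+ zero}    _ _ _ = inj₂ refl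
nonneg-sum≡1 {+ suc a} {+ suc b}   _ _ a+b≡1 =
  contradiction (ℕP.suc-injective (ℤP.+-injective a+b≡1)) (ℕP.m+1+n≢0 a)

pivot⇒InGraver : ∀ {m n} (M : Matrix m n) {u : Vector n} (j₀ : Fin n) →
  InKer M u → u j₀ ≡ 1ℤ →
  (∀ v → InKer M v → v ⊑ u → v j₀ ≡ 0ℤ → IsZero v) →
  InGraver M u
pivot⇒InGraver M {u} j₀ u∈ker u₀≡1 minimal = u∈ker , u≢0 , indecomposable
  where
  u≢0 : ¬ IsZero u
  u≢0 u≡0 = 1ℤ≢0ℤ (trans (sym u₀≡1) (u≡0 j₀))

  u₀≥0 : 0ℤ ℤ.≤ u j₀
  u₀≥0 = subst (0ℤ ℤ.≤_) (sym u₀≡1) (+≤+ z≤n)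

  indecomposable : ∀ v w → ¬ ConformalDecomp M u v w
  indecomposable v w decomp@(v∈ker , w∈ker , v≢0 , w≢0 , u≡v+w , _) =
    [ v≢0 ∘ minimal v v∈ker v⊑u , w≢0 ∘ minimal w w∈ker w⊑u ]′
      (nonneg-sum≡1 (≼-nonneg (v⊑u j₀) u₀≥0) (≼-nonneg (w⊑u j₀) u₀≥0)
                    (trans (sym (u≡v+w j₀)) u₀≡1))
    where
    v⊑u : v ⊑ u
    v⊑u = proj₁ (ConformalDecomp⇒⊑ {M = M} decomp)

    w⊑u : w ⊑ u
    w⊑u = proj₂ (ConformalDecomp⇒⊑ {M = M} decomp)

-- Lawrence liftings

lawrence-upper : ∀ {m n} r (A : Matrix m n) (b b′ : Fin r) k l →
  lawrence r A (join (r ℕ.* m) n (inj₁ (combine b k))) (combine b′ l)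
    ≡ (if does (b ≟ b′) then A k l else 0ℤ)
lawrence-upper {m} {n} r A b b′ k l
  rewrite FP.splitAt-join (r ℕ.* m) n (inj₁ (combine b k))
        | cong proj₁ (FP.remQuot-combine b′ l) | cong proj₂ (FP.remQuot-combine b′ l)
        | cong proj₁ (FP.remQuot-combine b k)  | cong proj₂ (FP.remQuot-combine b k) = refl

lawrence-lower : ∀ {m n} r (A : Matrix m n) (b′ : Fin r) k l →
  lawrence r A (join (r ℕ.* m) n (inj₂ k)) (combine b′ l)
    ≡ (if does (k ≟ l) then 1ℤ else 0ℤ)
lawrence-lower {m} {n} r A b′ k l
  rewrite FP.splitAt-join (r ℕ.* m) n (inj₂ {A = Fin (r ℕ.* m)} k)
        | cong proj₂ (FP.remQuot-combine b′ l) = refl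

indicator-* : ∀ (c : Bool) y → (if c then 1ℤ else 0ℤ) * y ≡ (if c then y else 0ℤ)
indicator-* true  y = ℤP.*-identityˡ y
indicator-* false y = refl

lawrence·-upper : ∀ {m n} r (A : Matrix m n) v (b : Fin r) k →
  (lawrence r A · v) (join (r ℕ.* m) n (inj₁ (combine b k))) ≡ (A · row r v b) k
lawrence·-upper {m} {n} r A v b k = begin
  sumℤ (λ j → L j * v j)
    ≡⟨ sumℤ-combine r n _ ⟩
  sumℤ (λ (b′ : Fin r) → sumℤ (λ (l : Fin n) → L (combine b′ l) * v (combine b′ l)))
    ≡⟨ sumℤ-cong (λ b′ → sumℤ-cong (λ l →
         trans (cong (_* v (combine b′ l)) (lawrence-upper r A b b′ k l))
               (if-float (_* v (combine b′ l)) (does (b ≟ b′))))) ⟩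
  sumℤ (λ (b′ : Fin r) → sumℤ (λ (l : Fin n) → if does (b ≟ b′) then A k l * v (combine b′ l) else 0ℤ))
    ≡⟨ sumℤ-cong (λ b′ → sumℤ-if (does (b ≟ b′)) (λ l → A k l * v (combine b′ l))) ⟩
  sumℤ (λ (b′ : Fin r) → if does (b ≟ b′) then (A · row r v b′) k else 0ℤ)
    ≡⟨ sumℤ-select b _ ⟩
  (A · row r v b) k ∎
  where
  L : Vector (r ℕ.* n)
  L = lawrence r A (join (r ℕ.* m) n (inj₁ (combine b k)))

lawrence·-lower : ∀ {m n} r (A : Matrix m n) v (l : Fin n) →
  (lawrence r A · v) (join (r ℕ.* m) n (inj₂ l)) ≡ sumℤ (λ b → row r v b l)
lawrence·-lower {m} {n} r A v l = begin
  sumℤ (λ j → L j * v j)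
    ≡⟨ sumℤ-combine r n _ ⟩
  sumℤ (λ (b : Fin r) → sumℤ (λ (l′ : Fin n) → L (combine b l′) * v (combine b l′)))
    ≡⟨ sumℤ-cong (λ b → sumℤ-cong (λ l′ →
         trans (cong (_* v (combine b l′)) (lawrence-lower r A b l l′))
               (indicator-* (does (l ≟ l′)) (v (combine b l′))))) ⟩
  sumℤ (λ (b : Fin r) → sumℤ (λ (l′ : Fin n) → if does (l ≟ l′) then v (combine b l′) else 0ℤ))
    ≡⟨ sumℤ-cong (λ b → sumℤ-select l (row r v b)) ⟩
  sumℤ (λ (b : Fin r) → row r v b l) ∎
  where
  L : Vector (r ℕ.* n)
  L = lawrence r A (join (r ℕ.* m) n (inj₂ l))

InKer-lawrence⇒rows : ∀ {m n} r (A : Matrix m n) v →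
  InKer (lawrence r A) v → ∀ b → InKer A (row r v b)
InKer-lawrence⇒rows r A v v∈ker b k = trans (sym (lawrence·-upper r A v b k)) (v∈ker _)

InKer-lawrence⇒columns : ∀ {m n} r (A : Matrix m n) v →
  InKer (lawrence r A) v → ∀ l → sumℤ (λ b → row r v b l) ≡ 0ℤ
InKer-lawrence⇒columns r A v v∈ker l = trans (sym (lawrence·-lower r A v l)) (v∈ker _)

fromRows : ∀ {r n} → (Fin r → Vector n) → Vector (r ℕ.* n)
fromRows {r} {n} U j = uncurry U (remQuot {r} n j)

row-fromRows : ∀ {r n} (U : Fin r → Vector n) b l → row r (fromRows U) b l ≡ U b l
row-fromRows U b l = cong (uncurry U) (FP.remQuot-combine b l)

·-cong : ∀ {m n} (A : Matrix m n) {x y : Vector n} → (∀ l → x l ≡ y l) → ∀ k → (A · x) k ≡ (A · y) k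
·-cong A x≗y k = sumℤ-cong (λ l → cong (A k l *_) (x≗y l))

fromRows-InKer-lawrence : ∀ {m n} r (A : Matrix m n) (U : Fin r → Vector n) →
  (∀ b → InKer A (U b)) → (∀ l → sumℤ (λ b → U b l) ≡ 0ℤ) →
  InKer (lawrence r A) (fromRows U)
fromRows-InKer-lawrence {m} {n} r A U rows cols i =
  subst (λ i → (lawrence r A · u) i ≡ 0ℤ) (FP.join-splitAt (r ℕ.* m) n i) (block (splitAt (r ℕ.* m) i))
  where
  u : Vector (r ℕ.* n)
  u = fromRows U

  block : ∀ s → (lawrence r A · u) (join (r ℕ.* m) n s) ≡ 0ℤ
  block (inj₁ i′) =
    subst (λ i′ → (lawrence r A · u) (join (r ℕ.* m) n (inj₁ i′)) ≡ 0ℤ)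
          (FP.combine-remQuot {r} m i′)
          (trans (lawrence·-upper r A u b k) (trans (·-cong A (row-fromRows U b) k) (rows b k)))
    where
    b : Fin r
    b = proj₁ (remQuot {r} m i′)

    k : Fin m
    k = proj₂ (remQuot {r} m i′)
  block (inj₂ l) =
    trans (lawrence·-lower r A u l) (trans (sumℤ-cong (λ b → row-fromRows U b l)) (cols l))

rows-zero⇒IsZero : ∀ {n} r {v : Vector (r ℕ.* n)} → (∀ b l → row r v b l ≡ 0ℤ) → IsZero v
rows-zero⇒IsZero {n} r {v} rows≡0 j =
  subst (λ j → v j ≡ 0ℤ) (FP.combine-remQuot {r} n j) (rows≡0 _ _)

countFin-all : ∀ {n} (g : Fin n → Bool) → (∀ i → g i ≡ true) → countFin g ≡ n
countFin-all {zero}  g all = refl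
countFin-all {suc n} g all rewrite all zero = cong suc (countFin-all (g ∘ suc) (all ∘ suc))

rows≢0⇒type≡r : ∀ {n} r (v : Vector (r ℕ.* n)) → (∀ b → ¬ IsZero (row r v b)) → type r v ≡ r
rows≢0⇒type≡r r v rows≢0 = countFin-all nonzero (λ b → cong not (dec-false (row-zero? b) (rows≢0 b)))
  where
  row-zero? : ∀ b → Dec (IsZero (row r v b))
  row-zero? b = FP.all? (λ l → row r v b l ℤP.≟ 0ℤ)

  nonzero : Fin r → Bool
  nonzero b = not (does (row-zero? b))

-- Rank

does-toℕ≟toℕ : ∀ {n} (a b : Fin n) → does (toℕ a ℕ.≟ toℕ b) ≡ does (a ≟ b)
does-toℕ≟toℕ a b with a ≟ b
... | yes refl = dec-true (toℕ a ℕ.≟ toℕ a) refl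
... | no  a≢b  = dec-false (toℕ a ℕ.≟ toℕ b) (a≢b ∘ FP.toℕ-injective)

*-indicator : ∀ x (c : Bool) → x * (if c then 1ℤ else 0ℤ) ≡ (if c then x else 0ℤ)
*-indicator x true  = ℤP.*-identityʳ x
*-indicator x false = ℤP.*-zeroʳ x

pivots⇒RowsIndependent : ∀ {m n k} (A : Matrix m n) (f : Fin k → Fin m) (pivot : Fin k → Fin n) →
  (∀ i i′ → A (f i′) (pivot i) ≡ (if does (i ≟ i′) then 1ℤ else 0ℤ)) →
  RowsIndependent A f
pivots⇒RowsIndependent A f pivot unit c combination≡0 i = begin
  c i                                                  ≡⟨ sumℤ-select i c ⟨
  sumℤ (λ i′ → if does (i ≟ i′) then c i′ else 0ℤ)    ≡⟨ sumℤ-cong (λ i′ → trans (cong (c i′ *_) (unit i i′))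
                                                                                (*-indicator (c i′) _)) ⟨
  sumℤ (λ i′ → c i′ * A (f i′) (pivot i))             ≡⟨ combination≡0 (pivot i) ⟩
  0ℤ                                                   ∎

zero-row⇒¬RowsIndependent : ∀ {m n k} (A : Matrix m n) (g : Fin k → Fin m) i₀ →
  (∀ l → A (g i₀) l ≡ 0ℤ) → ¬ RowsIndependent A g
zero-row⇒¬RowsIndependent A g i₀ row≡0 independent = 1ℤ≢0ℤ (begin
  1ℤ    ≡⟨ cong (if_then 1ℤ else 0ℤ) (dec-true (i₀ ≟ i₀) refl) ⟨
  δ i₀  ≡⟨ independent δ combination≡0 i₀ ⟩
  0ℤ    ∎)
  where
  δ : Fin _ → ℤ
  δ i = if does (i₀ ≟ i) then 1ℤ else 0ℤ

  combination≡0 : ∀ l → sumℤ (λ i → δ i * A (g i) l) ≡ 0ℤ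
  combination≡0 l = begin
    sumℤ (λ i → δ i * A (g i) l)                           ≡⟨ sumℤ-cong (λ i → indicator-* (does (i₀ ≟ i)) _) ⟩
    sumℤ (λ i → if does (i₀ ≟ i) then A (g i) l else 0ℤ)  ≡⟨ sumℤ-select i₀ _ ⟩
    A (g i₀) l                                             ≡⟨ row≡0 l ⟩
    0ℤ                                                     ∎

injective⇒∃toℕ≥ : ∀ {d m} (g : Fin (suc d) → Fin m) → Injective _≡_ _≡_ g → ∃ λ i → d ℕ.≤ toℕ (g i)
injective⇒∃toℕ≥ {d} g g-inj =
  map₂ ℕP.≮⇒≥ (FP.¬∀⟶∃¬ (suc d) _ (λ i → toℕ (g i) ℕ.<? d) not-all-below)
  where
  not-all-below : ¬ (∀ i → toℕ (g i) ℕ.< d)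
  not-all-below below = ℕP.n≮n d (FP.injective⇒≤ squeeze-injective)
    where
    squeeze : Fin (suc d) → Fin d
    squeeze i = fromℕ< (below i)

    squeeze-injective : Injective _≡_ _≡_ squeeze
    squeeze-injective {i} {j} eq = g-inj (FP.toℕ-injective (begin
      toℕ (g i)        ≡⟨ FP.toℕ-fromℕ< (below i) ⟨
      toℕ (squeeze i)  ≡⟨ cong toℕ eq ⟩
      toℕ (squeeze j)  ≡⟨ FP.toℕ-fromℕ< (below j) ⟩
      toℕ (g j)        ∎))

-- The witness

module Construction (K p e m : ℕ) (e≤p : e ℕ.≤ p) (e≤m : e ℕ.≤ m) where

  n d r : ℕ
  n = 3 ℕ.+ p
  d = suc e
  r = 2 ℕ.+ K

  entry : ℕ → ℕ → ℤ
  entry 0 0                         = 1ℤ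
  entry 0 1                         = 1ℤ
  entry 0 2                         = + K
  entry 0 (suc (suc (suc _)))       = 0ℤ
  entry (suc i) (suc (suc (suc j))) = if does (i ℕ.<? e) ∧ does (j ℕ.≟ i) then 1ℤ else 0ℤ
  entry (suc _) _                   = 0ℤ

  A : Matrix (suc m) n
  A k l = entry (toℕ k) (toℕ l)

  0F 1F 2F : Fin n
  0F = zero
  1F = suc zero
  2F = suc (suc zero)

  rowEmbedding : Fin d → Fin (suc m)
  rowEmbedding i = inject≤ i (s≤s e≤m)

  pivot : Fin d → Fin n
  pivot zero    = 0F
  pivot (suc i) = suc (suc (suc (inject≤ i e≤p)))

  A-pivots : ∀ i i′ → A (rowEmbedding i′) (pivot i) ≡ (if does (i ≟ i′) then 1ℤ else 0ℤ)
  A-pivots zero     zero      = refl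
  A-pivots zero     (suc _)   = refl
  A-pivots (suc _)  zero      = refl
  A-pivots (suc a)  (suc b)
    rewrite FP.toℕ-inject≤ a e≤p | FP.toℕ-inject≤ b e≤m
          | dec-true (toℕ b ℕ.<? e) (FP.toℕ<n b) = cong (if_then 1ℤ else 0ℤ) (does-toℕ≟toℕ a b)

  entry-vanishes : ∀ i → d ℕ.≤ i → ∀ l → entry i l ≡ 0ℤ
  entry-vanishes (suc i) (s≤s e≤i) 0 = refl
  entry-vanishes (suc i) (s≤s e≤i) 1 = refl
  entry-vanishes (suc i) (s≤s e≤i) 2 = refl
  entry-vanishes (suc i) (s≤s e≤i) (suc (suc (suc j)))
    rewrite dec-false (i ℕ.<? e) (ℕP.≤⇒≯ e≤i) = refl

  A-rank : HasRank A d
  A-rank = (rowEmbedding , FP.inject≤-injective _ _ _ _ , pivots⇒RowsIndependent A rowEmbedding pivot A-pivots)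
         , λ g g-inj → let (i₀ , d≤gi₀) = injective⇒∃toℕ≥ g g-inj in
             zero-row⇒¬RowsIndependent A g i₀ (λ l → entry-vanishes (toℕ (g i₀)) d≤gi₀ (toℕ l))

  A·-top : ∀ x → (A · x) zero ≡ x 0F + (x 1F + + K * x 2F)
  A·-top x = cong₂ _+_ (ℤP.*-identityˡ (x 0F)) (cong₂ _+_ (ℤP.*-identityˡ (x 1F))
               (trans (cong (_+_ (+ K * x 2F)) (sumℤ-zero {p} (λ _ → refl))) (ℤP.+-identityʳ _)))

  A·-below : ∀ x → (∀ j → x (suc (suc (suc j))) ≡ 0ℤ) → ∀ k → (A · x) (suc k) ≡ 0ℤ
  A·-below x tail≡0 k = cong (λ s → 0ℤ + (0ℤ + (0ℤ + s))) (sumℤ-zero {p} term≡0)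
    where
    term≡0 : ∀ j → A (suc k) (suc (suc (suc j))) * x (suc (suc (suc j))) ≡ 0ℤ
    term≡0 j = trans (cong (a *_) (tail≡0 j)) (ℤP.*-zeroʳ a)
      where a = A (suc k) (suc (suc (suc j)))

  U : Fin r → Vector n
  U zero          zero                = - + K
  U zero          (suc zero)          = 0ℤ
  U zero          (suc (suc zero))    = 1ℤ
  U zero          (suc (suc (suc _))) = 0ℤ
  U (suc zero)    zero                = 0ℤ
  U (suc zero)    (suc zero)          = + K
  U (suc zero)    (suc (suc zero))    = -1ℤ
  U (suc zero)    (suc (suc (suc _))) = 0ℤ
  U (suc (suc _)) zero                = 1ℤ
  U (suc (suc _)) (suc zero)          = -1ℤ
  U (suc (suc _)) (suc (suc _))       = 0ℤ

  u : Vector (r ℕ.* n)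
  u = fromRows U

  j₀ : Fin (r ℕ.* n)
  j₀ = combine {r} zero 2F

  -- Both the products of the rows of U with the first row of A and the column sums
  -- of U reduce to these three identities.
  cancel₀ : - + K + (0ℤ + + K * 1ℤ) ≡ 0ℤ
  cancel₀ = lemma (+ K) where lemma : ∀ k → - k + (0ℤ + k * 1ℤ) ≡ 0ℤ ; lemma = solve-∀

  cancel₁ : 0ℤ + (+ K + + K * -1ℤ) ≡ 0ℤ
  cancel₁ = lemma (+ K) where lemma : ∀ k → 0ℤ + (k + k * -1ℤ) ≡ 0ℤ ; lemma = solve-∀

  cancel₂ : 1ℤ + (-1ℤ + + K * 0ℤ) ≡ 0ℤ
  cancel₂ = cong (λ t → 1ℤ + (-1ℤ + t)) (ℤP.*-zeroʳ (+ K))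

  U-rows : ∀ b → InKer A (U b)
  U-rows zero          zero    = trans (A·-top (U zero)) cancel₀
  U-rows (suc zero)    zero    = trans (A·-top (U (suc zero))) cancel₁
  U-rows (suc (suc b)) zero    = trans (A·-top (U (suc (suc b)))) cancel₂
  U-rows b             (suc k) = A·-below (U b) (U-tail b) k
    where
    U-tail : ∀ b j → U b (suc (suc (suc j))) ≡ 0ℤ
    U-tail zero          _ = refl
    U-tail (suc zero)    _ = refl
    U-tail (suc (suc _)) _ = refl

  U-columns : ∀ l → sumℤ (λ b → U b l) ≡ 0ℤ
  U-columns zero                = trans (cong (λ s → - + K + (0ℤ + s)) (sumℤ-const {K} 1ℤ)) cancel₀
  U-columns (suc zero)          = trans (cong (λ s → 0ℤ + (+ K + s)) (sumℤ-const {K} -1ℤ)) cancel₁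
  U-columns (suc (suc zero))    = trans (cong (λ s → 1ℤ + (-1ℤ + s)) (sumℤ-const {K} 0ℤ)) cancel₂
  U-columns (suc (suc (suc l))) = cong (λ s → 0ℤ + (0ℤ + s)) (sumℤ-zero {K} (λ _ → refl))

  u∈ker : InKer (lawrence r A) u
  u∈ker = fromRows-InKer-lawrence r A U U-rows U-columns

  u-type : type {n} r u ≡ r
  u-type = rows≢0⇒type≡r {n} r u rows≢0
    where
    witness : Fin r → Fin n
    witness zero          = 2F
    witness (suc zero)    = 2F
    witness (suc (suc _)) = 0F

    U-witness≢0 : ∀ b → U b (witness b) ≢ 0ℤ
    U-witness≢0 zero          ()
    U-witness≢0 (suc zero)    ()
    U-witness≢0 (suc (suc _)) ()

    rows≢0 : ∀ b → ¬ IsZero (row r u b)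
    rows≢0 b row≡0 = U-witness≢0 b (trans (sym (row-fromRows U b (witness b))) (row≡0 (witness b)))

  u-minimal : ∀ v → InKer (lawrence r A) v → v ⊑ u → v j₀ ≡ 0ℤ → IsZero v
  u-minimal v v∈ker v⊑u v₀≡0 = rows-zero⇒IsZero r V≡0
    where
    V : Fin r → Vector n
    V = row r v

    V≼U : ∀ b l → V b l ≼ U b l
    V≼U b l = subst (V b l ≼_) (row-fromRows U b l) (v⊑u (combine b l))

    zero-at : ∀ b l → U b l ≡ 0ℤ → V b l ≡ 0ℤ
    zero-at b l U≡0 = ≼0⇒≡0 (subst (V b l ≼_) U≡0 (V≼U b l))

    scaled : ∀ {x} → x ≡ 0ℤ → + K * x ≡ 0ℤ
    scaled refl = ℤP.*-zeroʳ (+ K)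

    top : ∀ b → V b 0F + (V b 1F + + K * V b 2F) ≡ 0ℤ
    top b = trans (sym (A·-top (V b))) (InKer-lawrence⇒rows r A v v∈ker b zero)

    column : ∀ l → V zero l + (V (suc zero) l + sumℤ (λ b → V (suc (suc b)) l)) ≡ 0ℤ
    column = InKer-lawrence⇒columns r A v v∈ker

    V12≡0 : V (suc zero) 2F ≡ 0ℤ
    V12≡0 = x+[y+z]≡0⇒y≡0 v₀≡0 (sumℤ-zero (λ b → zero-at (suc (suc b)) 2F refl)) (column 2F)

    V00≡0 : V zero 0F ≡ 0ℤ
    V00≡0 = x+[y+z]≡0⇒x≡0 (zero-at zero 1F refl) (scaled v₀≡0) (top zero)

    V11≡0 : V (suc zero) 1F ≡ 0ℤ
    V11≡0 = x+[y+z]≡0⇒y≡0 (zero-at (suc zero) 0F refl) (scaled V12≡0) (top (suc zero))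

    Vb0≡0 : ∀ b → V (suc (suc b)) 0F ≡ 0ℤ
    Vb0≡0 = sumℤ-nonneg≡0⇒≡0 (λ b → ≼-nonneg (V≼U (suc (suc b)) 0F) (+≤+ z≤n))
              (x+[y+z]≡0⇒z≡0 V00≡0 (zero-at (suc zero) 0F refl) (column 0F))

    Vb1≡0 : ∀ b → V (suc (suc b)) 1F ≡ 0ℤ
    Vb1≡0 b = x+[y+z]≡0⇒y≡0 (Vb0≡0 b) (scaled (zero-at (suc (suc b)) 2F refl)) (top (suc (suc b)))

    V≡0 : ∀ b l → V b l ≡ 0ℤ
    V≡0 zero              zero                   = V00≡0
    V≡0 zero              (suc zero)             = zero-at zero 1F refl
    V≡0 zero              (suc (suc zero))       = v₀≡0
    V≡0 zero              l@(suc (suc (suc _)))  = zero-at zero l refl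
    V≡0 (suc zero)        zero                   = zero-at (suc zero) 0F refl
    V≡0 (suc zero)        (suc zero)             = V11≡0
    V≡0 (suc zero)        (suc (suc zero))       = V12≡0
    V≡0 (suc zero)        l@(suc (suc (suc _)))  = zero-at (suc zero) l refl
    V≡0 (suc (suc b))     zero                   = Vb0≡0 b
    V≡0 (suc (suc b))     (suc zero)             = Vb1≡0 b
    V≡0 b@(suc (suc _))   l@(suc (suc _))        = zero-at b l refl

  u∈Graver : InGraver (lawrence r A) u
  u∈Graver = pivot⇒InGraver (lawrence r A) j₀ u∈ker (row-fromRows U zero 2F) u-minimal

corollary6p3 : (n d m : ℕ) → 3 ≤ n → 1 ≤ d → d ≤ n ∸ 2 → d ≤ m →
    (N : ℕ) → 1 ≤ N →
    Σ (Matrix m n) λ A → HasRank A d × GraverComplexityAtLeast A N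
corollary6p3 (suc (suc (suc p))) (suc e) (suc m) (s≤s (s≤s (s≤s _))) (s≤s _) (s≤s e≤p) (s≤s e≤m) N _ =
  A , A-rank , r , s≤s (s≤s z≤n) , u , u∈Graver , subst (N ℕ.≤_) (sym u-type) (ℕP.m≤n+m N 2)
  where open Construction N p e m e≤p e≤m
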